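{- For all integers $n,k\ge0$, $$s_n(H_2^k)=\sum_{i=0}^{k-1}\binom{2n-i}{i}C_{n-i}.$$
   Context: Schröder paths: - A Schröder path is a finite word over $\{U,D,H_2\}$, viewed as a lattice path from $(0,0)$ with steps $U=(1,1)$, $D=(1,-1)$, $H_2=(2,0)$, ending on the $x$-axis and never going below it. The empty path is allowed. - Its semilength is (number of $U$'s) + (number of $H_2$'s). Notation and avoidance: - $H_2^k$ is the word consisting of $k$ letters $H_2$. - $Q$ avoids $P$ if $P$ is not a (not necessarily contiguous) subword of $Q$. - $s_n(P)$ is the number of Schröder paths of semilength $n$ avoiding $P$. Numbers appearing in the formula: $C_m=\frac{1}{m+1}\binom{2m}{m}$ is the $m$-th Catalan number, with $C_m=0$ for $m<0$. -}

module Defs where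

open import Data.Nat using (ℕ; zero; suc; _+_; _*_; _∸_; _/_; _≤ᵇ_)
open import Data.Nat.Combinatorics using (_C_)
open import Data.Bool using (if_then_else_)
open import Data.List using (List; []; _∷_; replicate; map; upTo)
open import Data.Nat.ListAction using (sum)
open import Data.List.Relation.Binary.Sublist.Propositional using (_⊆_)
open import Relation.Nullary using (¬_)

-- Steps of a Schröder path: U = (1,1), D = (1,-1), H₂ = (2,0)
data Step : Set where
  U D H₂ : Step

Word : Set
Word = List Step

data PathFrom : ℕ → Word → Set where
  end  : PathFrom 0 []
  up   : ∀ {h w} → PathFrom (suc h) w → PathFrom h (U ∷ w)
  down : ∀ {h w} → PathFrom h w → PathFrom (suc h) (D ∷ w)
  flat : ∀ {h w} → PathFrom h w → PathFrom h (H₂ ∷ w)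

IsSchroder : Word → Set
IsSchroder w = PathFrom 0 w

semilength : Word → ℕ
semilength []       = 0
semilength (U ∷ w)  = suc (semilength w)
semilength (D ∷ w)  = semilength w
semilength (H₂ ∷ w) = suc (semilength w)

Avoids : Word → Word → Set
Avoids Q P = ¬ (P ⊆ Q)

H₂^ : ℕ → Word
H₂^ k = replicate k H₂

catalan : ℕ → ℕ
catalan m = ((2 * m) C m) / suc m

-- C_{n-i} with the convention C_m = 0 for m < 0
catalanDiff : ℕ → ℕ → ℕ
catalanDiff n i = if i ≤ᵇ n then catalan (n ∸ i) else 0

rhs : ℕ → ℕ → ℕ
rhs n k = sum (map (λ i → ((2 * n ∸ i) C i) * catalanDiff n i) (upTo k))

-- A word avoids H₂^k iff it has fewer than k flat steps, so the paths counted split by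
-- their number i < k of flat steps.  Deleting the i flat steps of such a path leaves a
-- Dyck path of semilength n − i, and they can be put back anywhere among its 2n − 2i
-- steps: there are C(2n − i, i) · C_{n−i} of them.  To prove this, the paths from height
-- h with u up and t flat steps are enumerated by their first step, and their number
-- C(2u + h + t, t) · ballot u h is shown to satisfy the same recursion; ballot u 0 = C_u
-- follows from the reflection principle ballot u h = C(2u + h, u) − C(2u + h, u − 1).
module Submission where

open import Defs
open import Data.Nat using (ℕ)
open import Data.List using (List; length)
open import Data.List.Membership.Propositional using (_∈_)
open import Data.List.Relation.Unary.Unique.Propositional using (Unique)
open import Data.Product using (_×_; ∃-syntax)
open import Function.Bundles using (_⇔_)
open import Relation.Binary.PropositionalEquality using (_≡_)

open import Data.Bool using (true; false; if_then_else_)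
open import Data.Nat using (zero; suc; _+_; _*_; _∸_; _/_; _≤_; _<_; _≤ᵇ_; z≤n; s≤s; z<s; s<s)
open import Data.Nat.Properties
open import Data.Nat.Combinatorics using (_C_; nCk+nC[k+1]≡[n+1]C[k+1]; nCk≡nC[n∸k]; k>n⇒nCk≡0; nC1≡n)
open import Data.Nat.DivMod using (m*n/n≡m)
open import Data.Nat.ListAction using (sum)
open import Data.Nat.Tactic.RingSolver using (solve-∀)
open import Data.List using ([]; _∷_; map; concat; concatMap; upTo)
open import Data.List.Properties using (length-++; length-map; map-∘; map-cong; ∷-injectiveˡ; ∷-injectiveʳ)
open import Data.List.Membership.Propositional using (find; lose)
open import Data.List.Membership.Propositional.Properties
  using (∈-map⁺; ∈-map⁻; ∈-concat⁺′; ∈-concat⁻; ∈-concatMap⁺; ∈-concatMap⁻; ∈-upTo⁺; ∈-upTo⁻)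
open import Data.List.Relation.Unary.Any using (here; there)
open import Data.List.Relation.Unary.All as All using ([]; _∷_)
import Data.List.Relation.Unary.All.Properties as All
open import Data.List.Relation.Unary.AllPairs as AllPairs using ([]; _∷_)
import Data.List.Relation.Unary.AllPairs.Properties as AllPairs
import Data.List.Relation.Unary.Unique.Propositional.Properties as Unique
open import Data.List.Relation.Binary.Disjoint.Propositional using (Disjoint)
open import Data.List.Relation.Binary.Sublist.Propositional using (_⊆_; _∷_; _∷ʳ_; minimum)
open import Data.Product using (_,_)
open import Function.Bundles using (mk⇔; Equivalence)
open import Relation.Nullary using (contradiction)
open import Relation.Nullary.Reflects using (ofʸ; ofⁿ)
open import Relation.Binary.PropositionalEquality using (_≢_; refl; sym; trans; cong; cong₂; subst; module ≡-Reasoning)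
open ≡-Reasoning

k+m≡n⇒nCk≡nCm : ∀ {n} k m → k + m ≡ n → n C k ≡ n C m
k+m≡n⇒nCk≡nCm k m refl = begin
  (k + m) C k           ≡⟨ nCk≡nC[n∸k] (m≤m+n k m) ⟩
  (k + m) C (k + m ∸ k) ≡⟨ cong ((k + m) C_) (m+n∸m≡n k m) ⟩
  (k + m) C m           ∎

[k+1]*[n+1]C[k+1]≡[n+1]*nCk : ∀ n k → suc k * (suc n C suc k) ≡ suc n * (n C k)
[k+1]*[n+1]C[k+1]≡[n+1]*nCk zero zero = refl
[k+1]*[n+1]C[k+1]≡[n+1]*nCk zero (suc k) = begin
  suc (suc k) * (1 C suc (suc k)) ≡⟨ cong (suc (suc k) *_) (k>n⇒nCk≡0 {1} {suc (suc k)} (s<s z<s)) ⟩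
  suc (suc k) * 0                 ≡⟨ *-zeroʳ (suc (suc k)) ⟩
  0                               ≡⟨ cong (1 *_) (k>n⇒nCk≡0 {0} {suc k} z<s) ⟨
  1 * (0 C suc k)                 ∎
[k+1]*[n+1]C[k+1]≡[n+1]*nCk (suc n) zero = begin
  1 * (suc (suc n) C 1) ≡⟨ *-identityˡ _ ⟩
  suc (suc n) C 1       ≡⟨ nC1≡n (suc (suc n)) ⟩
  suc (suc n)           ≡⟨ *-identityʳ _ ⟨
  suc (suc n) * 1       ∎
[k+1]*[n+1]C[k+1]≡[n+1]*nCk (suc n) (suc k) = begin
  suc (suc k) * (suc (suc n) C suc (suc k))       ≡⟨ cong (suc (suc k) *_) (nCk+nC[k+1]≡[n+1]C[k+1] (suc n) (suc k)) ⟨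
  suc (suc k) * (A + B)                           ≡⟨ *-distribˡ-+ (suc (suc k)) A B ⟩
  (A + suc k * A) + suc (suc k) * B               ≡⟨ cong₂ (λ x y → (A + x) + y) ([k+1]*[n+1]C[k+1]≡[n+1]*nCk n k)
                                                                              ([k+1]*[n+1]C[k+1]≡[n+1]*nCk n (suc k)) ⟩
  (A + suc n * (n C k)) + suc n * (n C suc k)     ≡⟨ +-assoc A _ _ ⟩
  A + (suc n * (n C k) + suc n * (n C suc k))     ≡⟨ cong (A +_) (*-distribˡ-+ (suc n) (n C k) (n C suc k)) ⟨
  A + suc n * (n C k + n C suc k)                 ≡⟨ cong (λ x → A + suc n * x) (nCk+nC[k+1]≡[n+1]C[k+1] n k) ⟩
  suc (suc n) * A                                 ∎
  where
  A = suc n C suc k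
  B = suc n C suc (suc k)

[u+2]*[2u+2]Cu≡[u+1]*[2u+2]C[u+1] : ∀ u → suc (suc u) * (2 * suc u C u) ≡ suc u * (2 * suc u C suc u)
[u+2]*[2u+2]Cu≡[u+1]*[2u+2]C[u+1] u = begin
  suc (suc u) * (2 * suc u C u)           ≡⟨ cong (suc (suc u) *_) (k+m≡n⇒nCk≡nCm u (suc (suc u)) (u+[u+2]≡2[u+1] u)) ⟩
  suc (suc u) * (2 * suc u C suc (suc u)) ≡⟨ cong (λ m → suc (suc u) * (m C suc (suc u))) (2[u+1]≡1+[[u+1]+u] u) ⟩
  suc (suc u) * (suc K C suc (suc u))     ≡⟨ [k+1]*[n+1]C[k+1]≡[n+1]*nCk K (suc u) ⟩
  suc K * (K C suc u)                     ≡⟨ cong (suc K *_) (k+m≡n⇒nCk≡nCm (suc u) u refl) ⟩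
  suc K * (K C u)                         ≡⟨ [k+1]*[n+1]C[k+1]≡[n+1]*nCk K u ⟨
  suc u * (suc K C suc u)                 ≡⟨ cong (λ m → suc u * (m C suc u)) (2[u+1]≡1+[[u+1]+u] u) ⟨
  suc u * (2 * suc u C suc u)             ∎
  where
  K = suc u + u
  u+[u+2]≡2[u+1] : ∀ u → u + suc (suc u) ≡ 2 * suc u
  u+[u+2]≡2[u+1] = solve-∀
  2[u+1]≡1+[[u+1]+u] : ∀ u → 2 * suc u ≡ suc (suc u + u)
  2[u+1]≡1+[[u+1]+u] = solve-∀

-- ballot u h counts the up/down paths with u up steps that go from height h to the axis
-- without going below it.
ballot : ℕ → ℕ → ℕ
ballot zero    h       = 1
ballot (suc u) zero    = ballot u 1
ballot (suc u) (suc h) = ballot u (suc (suc h)) + ballot (suc u) h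

-- By reflection at height −1, the unrestricted up/down paths with u up steps from height h
-- to the axis that do go below it are counted by C(2u + h, u − 1).
belowAxis : ℕ → ℕ → ℕ
belowAxis zero    h = 0
belowAxis (suc u) h = (2 * suc u + h) C u

[1+2u+h]Cu≡belowAxis+[2u+h]Cu : ∀ u h → suc (2 * u + h) C u ≡ belowAxis u h + (2 * u + h) C u
[1+2u+h]Cu≡belowAxis+[2u+h]Cu zero    h = refl
[1+2u+h]Cu≡belowAxis+[2u+h]Cu (suc u) h = sym (nCk+nC[k+1]≡[n+1]C[k+1] (2 * suc u + h) u)

2[u+1]+h≡1+[2u+[h+1]] : ∀ u h → 2 * suc u + h ≡ suc (2 * u + suc h)
2[u+1]+h≡1+[2u+[h+1]] = solve-∀

ballot+belowAxis≡[2u+h]Cu : ∀ u h → ballot u h + belowAxis u h ≡ (2 * u + h) C u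
ballot+belowAxis≡[2u+h]Cu zero    h    = refl
ballot+belowAxis≡[2u+h]Cu (suc u) zero = begin
  ballot u 1 + N C u                     ≡⟨ cong (λ n → ballot u 1 + n C u) (2[u+1]+h≡1+[2u+[h+1]] u 0) ⟩
  ballot u 1 + suc K C u                 ≡⟨ cong (ballot u 1 +_) ([1+2u+h]Cu≡belowAxis+[2u+h]Cu u 1) ⟩
  ballot u 1 + (belowAxis u 1 + K C u)   ≡⟨ +-assoc (ballot u 1) _ _ ⟨
  (ballot u 1 + belowAxis u 1) + K C u   ≡⟨ cong (_+ K C u) (ballot+belowAxis≡[2u+h]Cu u 1) ⟩
  K C u + K C u                          ≡⟨ cong (K C u +_) (k+m≡n⇒nCk≡nCm u (suc u) (u+[u+1]≡2u+1 u)) ⟩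
  K C u + K C suc u                      ≡⟨ nCk+nC[k+1]≡[n+1]C[k+1] K u ⟩
  suc K C suc u                          ≡⟨ cong (_C suc u) (2[u+1]+h≡1+[2u+[h+1]] u 0) ⟨
  N C suc u                              ∎
  where
  N = 2 * suc u + 0
  K = 2 * u + 1
  u+[u+1]≡2u+1 : ∀ u → u + suc u ≡ 2 * u + 1
  u+[u+1]≡2u+1 = solve-∀
ballot+belowAxis≡[2u+h]Cu (suc u) (suc h) = begin
  (B₁ + B₂) + N C u            ≡⟨ cong (λ n → (B₁ + B₂) + n C u) (2[u+1]+h≡1+[2u+[h+1]] u (suc h)) ⟩
  (B₁ + B₂) + suc K C u        ≡⟨ cong ((B₁ + B₂) +_) ([1+2u+h]Cu≡belowAxis+[2u+h]Cu u (suc (suc h))) ⟩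
  (B₁ + B₂) + (R₁ + K C u)     ≡⟨ +-assoc-middle B₁ B₂ R₁ (K C u) ⟩
  (B₁ + R₁) + (B₂ + K C u)     ≡⟨ cong₂ _+_ (ballot+belowAxis≡[2u+h]Cu u (suc (suc h)))
                                            (subst (λ n → B₂ + n C u ≡ n C suc u) M≡K (ballot+belowAxis≡[2u+h]Cu (suc u) h)) ⟩
  K C u + K C suc u            ≡⟨ nCk+nC[k+1]≡[n+1]C[k+1] K u ⟩
  suc K C suc u                ≡⟨ cong (_C suc u) (2[u+1]+h≡1+[2u+[h+1]] u (suc h)) ⟨
  N C suc u                    ∎
  where
  B₁ = ballot u (suc (suc h))
  B₂ = ballot (suc u) h
  R₁ = belowAxis u (suc (suc h))
  N = 2 * suc u + suc h
  K = 2 * u + suc (suc h)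
  M≡K : 2 * suc u + h ≡ K
  M≡K = trans (2[u+1]+h≡1+[2u+[h+1]] u h) (sym (+-suc (2 * u) (suc h)))
  +-assoc-middle : ∀ a b c d → (a + b) + (c + d) ≡ (a + c) + (b + d)
  +-assoc-middle = solve-∀

[u+1]*ballot≡[2u]Cu : ∀ u → suc u * ballot u 0 ≡ (2 * u) C u
[u+1]*ballot≡[2u]Cu zero    = refl
[u+1]*ballot≡[2u]Cu (suc u) = +-cancelʳ-≡ (suc u * X) _ _ (begin
  suc (suc u) * B + suc u * X          ≡⟨ cong (suc (suc u) * B +_) ([u+2]*[2u+2]Cu≡[u+1]*[2u+2]C[u+1] u) ⟨
  suc (suc u) * B + suc (suc u) * Y    ≡⟨ *-distribˡ-+ (suc (suc u)) B Y ⟨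
  suc (suc u) * (B + Y)                ≡⟨ cong (suc (suc u) *_) reflection ⟩
  suc (suc u) * X                      ∎)
  where
  B = ballot (suc u) 0
  X = 2 * suc u C suc u
  Y = 2 * suc u C u
  reflection : B + Y ≡ X
  reflection = subst (λ n → B + n C u ≡ n C suc u) (+-identityʳ (2 * suc u)) (ballot+belowAxis≡[2u+h]Cu (suc u) 0)

ballot≡catalan : ∀ u → ballot u 0 ≡ catalan u
ballot≡catalan u = begin
  ballot u 0                       ≡⟨ m*n/n≡m (ballot u 0) (suc u) ⟨
  (ballot u 0 * suc u) / suc u     ≡⟨ cong (_/ suc u) (*-comm (ballot u 0) (suc u)) ⟩
  (suc u * ballot u 0) / suc u     ≡⟨ cong (_/ suc u) ([u+1]*ballot≡[2u]Cu u) ⟩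
  ((2 * u) C u) / suc u            ∎

length-concat : ∀ {A : Set} (xss : List (List A)) → length (concat xss) ≡ sum (map length xss)
length-concat []         = refl
length-concat (xs ∷ xss) = trans (length-++ xs) (cong (length xs +_) (length-concat xss))

concatMap-unique : ∀ {A B : Set} (f : A → List B) (key : B → A) {xs} →
  (∀ {x y} → y ∈ f x → key y ≡ x) → (∀ x → Unique (f x)) → Unique xs → Unique (concatMap f xs)
concatMap-unique f key {xs} key-f f-unique xs-unique =
  Unique.concat⁺ (All.map⁺ (All.universal f-unique xs)) (AllPairs.map⁺ (AllPairs.map disjoint xs-unique))
  where
  disjoint : ∀ {x x′} → x ≢ x′ → Disjoint (f x) (f x′)
  disjoint x≢x′ (y∈ , y∈′) = x≢x′ (trans (sym (key-f y∈)) (key-f y∈′))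

length-concatMap : ∀ {A B : Set} (f : A → List B) xs → length (concatMap f xs) ≡ sum (map (λ x → length (f x)) xs)
length-concatMap f xs = trans (length-concat (map f xs)) (cong sum (sym (map-∘ xs)))

countU : Word → ℕ
countU []       = 0
countU (U ∷ w)  = suc (countU w)
countU (D ∷ w)  = countU w
countU (H₂ ∷ w) = countU w

countH₂ : Word → ℕ
countH₂ []       = 0
countH₂ (U ∷ w)  = countH₂ w
countH₂ (D ∷ w)  = countH₂ w
countH₂ (H₂ ∷ w) = suc (countH₂ w)

semilength≡countU+countH₂ : ∀ w → semilength w ≡ countU w + countH₂ w
semilength≡countU+countH₂ []       = refl
semilength≡countU+countH₂ (U ∷ w)  = cong suc (semilength≡countU+countH₂ w)
semilength≡countU+countH₂ (D ∷ w)  = semilength≡countU+countH₂ w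
semilength≡countU+countH₂ (H₂ ∷ w) =
  trans (cong suc (semilength≡countU+countH₂ w)) (sym (+-suc (countU w) (countH₂ w)))

countH₂≤semilength : ∀ w → countH₂ w ≤ semilength w
countH₂≤semilength w = subst (countH₂ w ≤_) (sym (semilength≡countU+countH₂ w)) (m≤n+m (countH₂ w) (countU w))

countU≡semilength∸countH₂ : ∀ w → countU w ≡ semilength w ∸ countH₂ w
countU≡semilength∸countH₂ w = begin
  countU w                        ≡⟨ m+n∸n≡m (countU w) (countH₂ w) ⟨
  countU w + countH₂ w ∸ countH₂ w ≡⟨ cong (_∸ countH₂ w) (semilength≡countU+countH₂ w) ⟨
  semilength w ∸ countH₂ w        ∎

H₂^⊆⇒≤countH₂ : ∀ k w → H₂^ k ⊆ w → k ≤ countH₂ w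
H₂^⊆⇒≤countH₂ zero    w          _           = z≤n
H₂^⊆⇒≤countH₂ (suc k) (U ∷ w)    (.U ∷ʳ s)   = H₂^⊆⇒≤countH₂ (suc k) w s
H₂^⊆⇒≤countH₂ (suc k) (D ∷ w)    (.D ∷ʳ s)   = H₂^⊆⇒≤countH₂ (suc k) w s
H₂^⊆⇒≤countH₂ (suc k) (H₂ ∷ w)   (.H₂ ∷ʳ s)  = m≤n⇒m≤1+n (H₂^⊆⇒≤countH₂ (suc k) w s)
H₂^⊆⇒≤countH₂ (suc k) (H₂ ∷ w)   (refl ∷ s)  = s≤s (H₂^⊆⇒≤countH₂ k w s)

≤countH₂⇒H₂^⊆ : ∀ k w → k ≤ countH₂ w → H₂^ k ⊆ w
≤countH₂⇒H₂^⊆ zero    w        _         = minimum w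
≤countH₂⇒H₂^⊆ (suc k) (U ∷ w)  k≤        = U ∷ʳ ≤countH₂⇒H₂^⊆ (suc k) w k≤
≤countH₂⇒H₂^⊆ (suc k) (D ∷ w)  k≤        = D ∷ʳ ≤countH₂⇒H₂^⊆ (suc k) w k≤
≤countH₂⇒H₂^⊆ (suc k) (H₂ ∷ w) (s≤s k≤)  = refl ∷ ≤countH₂⇒H₂^⊆ k w k≤

avoids-H₂^⇔countH₂< : ∀ k w → Avoids w (H₂^ k) ⇔ countH₂ w < k
avoids-H₂^⇔countH₂< k w = mk⇔
  (λ avoids → ≰⇒> (λ k≤ → avoids (≤countH₂⇒H₂^⊆ k w k≤)))
  (λ countH₂<k ⊆w → <⇒≱ countH₂<k (H₂^⊆⇒≤countH₂ k w ⊆w))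

PathOfShape : ℕ → ℕ → ℕ → Word → Set
PathOfShape u h t w = PathFrom h w × countU w ≡ u × countH₂ w ≡ t

-- The clauses split on t first, so that emptyPath u h (suc t) reduces for variable u, h.
emptyPath : ℕ → ℕ → ℕ → List Word
emptyPath u       h       (suc t) = []
emptyPath u       (suc h) zero    = []
emptyPath (suc u) zero    zero    = []
emptyPath zero    zero    zero    = [] ∷ []

mutual
  paths : ℕ → ℕ → ℕ → List Word
  paths u h t = concat (pieces u h t)

  pieces : ℕ → ℕ → ℕ → List (List Word)
  pieces u h t = emptyPath u h t ∷ extensions U u h t ∷ extensions D u h t ∷ extensions H₂ u h t ∷ []

  extensions : Step → ℕ → ℕ → ℕ → List Word
  extensions s u h t = map (s ∷_) (pathsAfter s u h t)

  pathsAfter : Step → ℕ → ℕ → ℕ → List Word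
  pathsAfter U  (suc u) h       t       = paths u (suc h) t
  pathsAfter D  u       (suc h) t       = paths u h t
  pathsAfter H₂ u       h       (suc t) = paths u h t
  pathsAfter _  _       _       _       = []

∈-extension : ∀ s u h t {v} → v ∈ pathsAfter s u h t → s ∷ v ∈ paths u h t
∈-extension s u h t v∈ = ∈-concat⁺′ (∈-map⁺ (s ∷_) v∈) (extensions∈pieces s)
  where
  extensions∈pieces : ∀ s → extensions s u h t ∈ pieces u h t
  extensions∈pieces U  = there (here refl)
  extensions∈pieces D  = there (there (here refl))
  extensions∈pieces H₂ = there (there (there (here refl)))

∈-paths⁺ : ∀ {h w} → PathFrom h w → w ∈ paths (countU w) h (countH₂ w)
∈-paths⁺         end              = here refl
∈-paths⁺ {h}     (up {w = w} p)   = ∈-extension U (suc (countU w)) h (countH₂ w) (∈-paths⁺ p)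
∈-paths⁺ {suc h} (down {w = w} p) = ∈-extension D (countU w) (suc h) (countH₂ w) (∈-paths⁺ p)
∈-paths⁺ {h}     (flat {w = w} p) = ∈-extension H₂ (countU w) h (suc (countH₂ w)) (∈-paths⁺ p)

mutual
  ∈-paths⁻ : ∀ u h t {w} → w ∈ paths u h t → PathOfShape u h t w
  ∈-paths⁻ u h t w∈ with ∈-concat⁻ (pieces u h t) w∈
  ... | here w∈e                         = ∈-emptyPath⁻ u h t w∈e
  ... | there (here w∈x)                 = ∈-extensions⁻ U u h t w∈x
  ... | there (there (here w∈x))         = ∈-extensions⁻ D u h t w∈x
  ... | there (there (there (here w∈x))) = ∈-extensions⁻ H₂ u h t w∈x

  ∈-emptyPath⁻ : ∀ u h t {w} → w ∈ emptyPath u h t → PathOfShape u h t w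
  ∈-emptyPath⁻ zero zero zero (here refl) = end , refl , refl

  ∈-extensions⁻ : ∀ s u h t {w} → w ∈ extensions s u h t → PathOfShape u h t w
  ∈-extensions⁻ s u h t w∈ with ∈-map⁻ (s ∷_) w∈
  ... | v , v∈ , refl = ∈-pathsAfter⁻ s u h t v∈

  ∈-pathsAfter⁻ : ∀ s u h t {v} → v ∈ pathsAfter s u h t → PathOfShape u h t (s ∷ v)
  ∈-pathsAfter⁻ U (suc u) h t v∈ with p , refl , refl ← ∈-paths⁻ u (suc h) t v∈ = up p , refl , refl
  ∈-pathsAfter⁻ D u (suc h) t v∈ with p , refl , refl ← ∈-paths⁻ u h t v∈ = down p , refl , refl
  ∈-pathsAfter⁻ H₂ u h (suc t) v∈ with p , refl , refl ← ∈-paths⁻ u h t v∈ = flat p , refl , refl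

emptyPath-unique : ∀ u h t → Unique (emptyPath u h t)
emptyPath-unique u       h       (suc t) = []
emptyPath-unique u       (suc h) zero    = []
emptyPath-unique (suc u) zero    zero    = []
emptyPath-unique zero    zero    zero    = [] ∷ []

emptyPath-disjoint : ∀ u h t s (ws : List Word) → Disjoint (emptyPath u h t) (map (s ∷_) ws)
emptyPath-disjoint zero zero zero s ws (here refl , []∈) with ∈-map⁻ (s ∷_) []∈
... | _ , _ , ()

map-∷-disjoint : ∀ {s s′} → s ≢ s′ → (ws ws′ : List Word) → Disjoint (map (s ∷_) ws) (map (s′ ∷_) ws′)
map-∷-disjoint s≢s′ ws ws′ (w∈ , w∈′) with ∈-map⁻ _ w∈ | ∈-map⁻ _ w∈′
... | _ , _ , refl | _ , _ , eq = s≢s′ (∷-injectiveˡ eq)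

mutual
  paths-unique : ∀ u h t → Unique (paths u h t)
  paths-unique u h t = Unique.concat⁺
    (emptyPath-unique u h t ∷ extensions-unique U u h t ∷ extensions-unique D u h t ∷ extensions-unique H₂ u h t ∷ [])
    ((E U ∷ E D ∷ E H₂ ∷ []) ∷ (X (λ ()) ∷ X (λ ()) ∷ []) ∷ (X (λ ()) ∷ []) ∷ [] ∷ [])
    where
    E : ∀ s → Disjoint (emptyPath u h t) (extensions s u h t)
    E s = emptyPath-disjoint u h t s _
    X : ∀ {s s′} → s ≢ s′ → Disjoint (extensions s u h t) (extensions s′ u h t)
    X s≢s′ = map-∷-disjoint s≢s′ _ _

  extensions-unique : ∀ s u h t → Unique (extensions s u h t)
  extensions-unique s u h t = Unique.map⁺ ∷-injectiveʳ (pathsAfter-unique s u h t)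

  pathsAfter-unique : ∀ s u h t → Unique (pathsAfter s u h t)
  pathsAfter-unique U  (suc u) h       t       = paths-unique u (suc h) t
  pathsAfter-unique D  u       (suc h) t       = paths-unique u h t
  pathsAfter-unique H₂ u       h       (suc t) = paths-unique u h t
  pathsAfter-unique U  zero    h       t       = []
  pathsAfter-unique D  u       zero    t       = []
  pathsAfter-unique H₂ u       h       zero    = []

pathCount : ℕ → ℕ → ℕ → ℕ
pathCount u h t = ((2 * u + h + t) C t) * ballot u h

countAfter : Step → ℕ → ℕ → ℕ → ℕ
countAfter U  (suc u) h       t       = pathCount u (suc h) t
countAfter D  u       (suc h) t       = pathCount u h t
countAfter H₂ u       h       (suc t) = pathCount u h t
countAfter _  _       _       _       = 0

C[t+1]*ballot≡countAfterU+countAfterD : ∀ u h t →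
  ((2 * u + h + t) C suc t) * ballot u h ≡ countAfter U u h (suc t) + countAfter D u h (suc t)
C[t+1]*ballot≡countAfterU+countAfterD zero    zero    t = cong (_* 1) (k>n⇒nCk≡0 (n<1+n t))
C[t+1]*ballot≡countAfterU+countAfterD zero    (suc h) t = cong (λ n → (n C suc t) * 1) (sym (+-suc h t))
C[t+1]*ballot≡countAfterU+countAfterD (suc u) zero    t = begin
  (a C suc t) * ballot u 1                       ≡⟨ cong (λ n → (n C suc t) * ballot u 1) (shift u t) ⟩
  pathCount u 1 (suc t)                          ≡⟨ +-identityʳ _ ⟨
  pathCount u 1 (suc t) + 0                      ∎
  where
  a = 2 * suc u + 0 + t
  shift : ∀ u t → 2 * suc u + 0 + t ≡ 2 * u + 1 + suc t
  shift = solve-∀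
C[t+1]*ballot≡countAfterU+countAfterD (suc u) (suc h) t = begin
  (a C suc t) * (B₁ + B₂)                        ≡⟨ *-distribˡ-+ (a C suc t) B₁ B₂ ⟩
  (a C suc t) * B₁ + (a C suc t) * B₂            ≡⟨ cong₂ (λ m n → (m C suc t) * B₁ + (n C suc t) * B₂)
                                                           (shiftU u h t) (shiftD u h t) ⟩
  pathCount u (suc (suc h)) (suc t) + pathCount (suc u) h (suc t) ∎
  where
  a = 2 * suc u + suc h + t
  B₁ = ballot u (suc (suc h))
  B₂ = ballot (suc u) h
  shiftU : ∀ u h t → 2 * suc u + suc h + t ≡ 2 * u + suc (suc h) + suc t
  shiftU = solve-∀
  shiftD : ∀ u h t → 2 * suc u + suc h + t ≡ 2 * suc u + h + suc t
  shiftD = solve-∀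

pathCount-rec : ∀ u h t → pathCount u h t ≡
  sum (length (emptyPath u h t) ∷ countAfter U u h t ∷ countAfter D u h t ∷ countAfter H₂ u h t ∷ [])
pathCount-rec zero    zero    zero    = refl
pathCount-rec zero    (suc h) zero    = refl
pathCount-rec (suc u) zero    zero    = sym (+-identityʳ (ballot u 1 + 0))
pathCount-rec (suc u) (suc h) zero    = rearrange (ballot u (suc (suc h))) (ballot (suc u) h)
  where
  rearrange : ∀ a b → (a + b) + 0 ≡ (a + 0) + ((b + 0) + 0)
  rearrange = solve-∀
pathCount-rec u       h       (suc t) = begin
  ((2 * u + h + suc t) C suc t) * B          ≡⟨ cong (λ n → (n C suc t) * B) (+-suc (2 * u + h) t) ⟩
  (suc n C suc t) * B                        ≡⟨ cong (_* B) (nCk+nC[k+1]≡[n+1]C[k+1] n t) ⟨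
  (n C t + n C suc t) * B                    ≡⟨ *-distribʳ-+ B (n C t) (n C suc t) ⟩
  pathCount u h t + (n C suc t) * B          ≡⟨ cong (pathCount u h t +_) (C[t+1]*ballot≡countAfterU+countAfterD u h t) ⟩
  pathCount u h t + (cU + cD)                ≡⟨ rearrange (pathCount u h t) cU cD ⟩
  0 + (cU + (cD + (pathCount u h t + 0)))    ∎
  where
  n = 2 * u + h + t
  B = ballot u h
  cU = countAfter U u h (suc t)
  cD = countAfter D u h (suc t)
  rearrange : ∀ p a b → p + (a + b) ≡ 0 + (a + (b + (p + 0)))
  rearrange = solve-∀

mutual
  length-paths : ∀ u h t → length (paths u h t) ≡ pathCount u h t
  length-paths u h t = begin
    length (paths u h t)            ≡⟨ length-concat (pieces u h t) ⟩
    sum (map length (pieces u h t)) ≡⟨ cong (length (emptyPath u h t) +_)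
                                         (cong₂ _+_ (length-extensions U u h t)
                                           (cong₂ _+_ (length-extensions D u h t)
                                             (cong (_+ 0) (length-extensions H₂ u h t)))) ⟩
    sum (length (emptyPath u h t) ∷ countAfter U u h t ∷ countAfter D u h t ∷ countAfter H₂ u h t ∷ [])
                                    ≡⟨ pathCount-rec u h t ⟨
    pathCount u h t                 ∎

  length-extensions : ∀ s u h t → length (extensions s u h t) ≡ countAfter s u h t
  length-extensions s u h t = trans (length-map (s ∷_) (pathsAfter s u h t)) (length-pathsAfter s u h t)

  length-pathsAfter : ∀ s u h t → length (pathsAfter s u h t) ≡ countAfter s u h t
  length-pathsAfter U  (suc u) h       t       = length-paths u (suc h) t
  length-pathsAfter D  u       (suc h) t       = length-paths u h t
  length-pathsAfter H₂ u       h       (suc t) = length-paths u h t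
  length-pathsAfter U  zero    h       t       = refl
  length-pathsAfter D  u       zero    t       = refl
  length-pathsAfter H₂ u       h       zero    = refl

schröderWithFlats : ℕ → ℕ → List Word
schröderWithFlats n i = if i ≤ᵇ n then paths (n ∸ i) 0 i else []

∈-schröderWithFlats⇔ : ∀ n i w →
  w ∈ schröderWithFlats n i ⇔ (IsSchroder w × semilength w ≡ n × countH₂ w ≡ i)
∈-schröderWithFlats⇔ n i w = mk⇔ to from
  where
  to : w ∈ schröderWithFlats n i → IsSchroder w × semilength w ≡ n × countH₂ w ≡ i
  to w∈ with i ≤ᵇ n | ≤ᵇ-reflects-≤ i n
  ... | true | ofʸ i≤n with p , countU≡ , countH₂≡ ← ∈-paths⁻ (n ∸ i) 0 i w∈ = p , semilength≡n , countH₂≡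
    where
    semilength≡n : semilength w ≡ n
    semilength≡n = begin
      semilength w          ≡⟨ semilength≡countU+countH₂ w ⟩
      countU w + countH₂ w  ≡⟨ cong₂ _+_ countU≡ countH₂≡ ⟩
      n ∸ i + i             ≡⟨ m∸n+n≡m i≤n ⟩
      n                     ∎
  from : IsSchroder w × semilength w ≡ n × countH₂ w ≡ i → w ∈ schröderWithFlats n i
  from (p , refl , refl) with countH₂ w ≤ᵇ semilength w | ≤ᵇ-reflects-≤ (countH₂ w) (semilength w)
  ... | true  | _       = subst (λ u → w ∈ paths u 0 (countH₂ w)) (countU≡semilength∸countH₂ w) (∈-paths⁺ p)
  ... | false | ofⁿ i≰n = contradiction (countH₂≤semilength w) i≰n

schröderWithFlats-unique : ∀ n i → Unique (schröderWithFlats n i)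
schröderWithFlats-unique n i with i ≤ᵇ n
... | true  = paths-unique (n ∸ i) 0 i
... | false = []

length-schröderWithFlats : ∀ n i → length (schröderWithFlats n i) ≡ ((2 * n ∸ i) C i) * catalanDiff n i
length-schröderWithFlats n i with i ≤ᵇ n | ≤ᵇ-reflects-≤ i n
... | true  | ofʸ i≤n = begin
  length (paths (n ∸ i) 0 i)                     ≡⟨ length-paths (n ∸ i) 0 i ⟩
  ((2 * (n ∸ i) + 0 + i) C i) * ballot (n ∸ i) 0 ≡⟨ cong₂ (λ m b → (m C i) * b) length≡ (ballot≡catalan (n ∸ i)) ⟩
  ((2 * n ∸ i) C i) * catalan (n ∸ i)            ∎
  where
  length≡ : 2 * (n ∸ i) + 0 + i ≡ 2 * n ∸ i
  length≡ = begin
    2 * (n ∸ i) + 0 + i            ≡⟨ m+n∸n≡m _ i ⟨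
    2 * (n ∸ i) + 0 + i + i ∸ i    ≡⟨ cong (_∸ i) (double (n ∸ i) i) ⟩
    2 * (n ∸ i + i) ∸ i            ≡⟨ cong (λ m → 2 * m ∸ i) (m∸n+n≡m i≤n) ⟩
    2 * n ∸ i                      ∎
    where
    double : ∀ m i → 2 * m + 0 + i + i ≡ 2 * (m + i)
    double = solve-∀
... | false | ofⁿ _   = sym (*-zeroʳ ((2 * n ∸ i) C i))

schröderAvoiding : ℕ → ℕ → List Word
schröderAvoiding n k = concatMap (schröderWithFlats n) (upTo k)

∈-schröderAvoiding⇔ : ∀ n k w →
  w ∈ schröderAvoiding n k ⇔ (IsSchroder w × semilength w ≡ n × Avoids w (H₂^ k))
∈-schröderAvoiding⇔ n k w = mk⇔ to from
  where
  to : w ∈ schröderAvoiding n k → IsSchroder w × semilength w ≡ n × Avoids w (H₂^ k)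
  to w∈ with i , i∈ , w∈i ← find (∈-concatMap⁻ (schröderWithFlats n) w∈)
            with p , semilength≡n , refl ← Equivalence.to (∈-schröderWithFlats⇔ n i w) w∈i
    = p , semilength≡n , Equivalence.from (avoids-H₂^⇔countH₂< k w) (∈-upTo⁻ i∈)
  from : IsSchroder w × semilength w ≡ n × Avoids w (H₂^ k) → w ∈ schröderAvoiding n k
  from (p , semilength≡n , avoids) = ∈-concatMap⁺ (schröderWithFlats n)
    (lose (∈-upTo⁺ (Equivalence.to (avoids-H₂^⇔countH₂< k w) avoids))
          (Equivalence.from (∈-schröderWithFlats⇔ n (countH₂ w) w) (p , semilength≡n , refl)))

schröderAvoiding-unique : ∀ n k → Unique (schröderAvoiding n k)
schröderAvoiding-unique n k =
  concatMap-unique (schröderWithFlats n) countH₂ countH₂≡ (schröderWithFlats-unique n) (Unique.upTo⁺ k)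
  where
  countH₂≡ : ∀ {i w} → w ∈ schröderWithFlats n i → countH₂ w ≡ i
  countH₂≡ {i} {w} w∈ with _ , _ , eq ← Equivalence.to (∈-schröderWithFlats⇔ n i w) w∈ = eq

length-schröderAvoiding : ∀ n k → length (schröderAvoiding n k) ≡ rhs n k
length-schröderAvoiding n k = begin
  length (schröderAvoiding n k)
    ≡⟨ length-concatMap (schröderWithFlats n) (upTo k) ⟩
  sum (map (λ i → length (schröderWithFlats n i)) (upTo k))
    ≡⟨ cong sum (map-cong (length-schröderWithFlats n) (upTo k)) ⟩
  sum (map (λ i → ((2 * n ∸ i) C i) * catalanDiff n i) (upTo k))
    ∎

mainTheorem6 : (n k : ℕ) →
    ∃[ L ] (Unique L
    × (∀ (w : Word) → (w ∈ L) ⇔ (IsSchroder w × semilength w ≡ n × Avoids w (H₂^ k)))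
    × length L ≡ rhs n k)
mainTheorem6 n k =
  schröderAvoiding n k , schröderAvoiding-unique n k , ∈-schröderAvoiding⇔ n k , length-schröderAvoiding n k
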